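{- Let $G=\{\cdot\mid *\}$ and let $\mathcal{U}=\mathcal{D}(G)$. Then $G\equiv_{\mathcal{U}}0$.
   Context: Games are finite partizan games $\{\mathscr{G}^L\mid\mathscr{G}^R\}$, $\cdot$ denoting no options; $0=\{\cdot\mid\cdot\}$, $*=\{0\mid0\}$. Sum $G+H=\{G^L+H,G+H^L\mid G^R+H,G+H^R\}$; conjugate $\overline{G}=\{\overline{G^R}\mid\overline{G^L}\}$. Misère outcomes: $o^L(G)=\mathscr{L}$ iff $G$ has no Left option or some $o^R(G^L)=\mathscr{L}$ (else $\mathscr{R}$); $o^R(G)=\mathscr{R}$ iff $G$ has no Right option or some $o^L(G^R)=\mathscr{R}$ (else $\mathscr{L}$); $o(G)$ is the pair $(o^L(G),o^R(G))$. A universe is a set of games closed under options, sums, conjugates, and forming $\{\mathscr{S}\mid\mathscr{T}\}$ for nonempty finite subsets $\mathscr{S},\mathscr{T}$; $\mathcal{D}(\mathcal{A})$ is the smallest universe containing $\mathcal{A}$. $G\equiv_{\mathcal{U}}H$ means $o(G+X)=o(H+X)$ for all $X\in\mathcal{U}$. -}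

module Defs where

open import Data.List using (List; []; _∷_; _++_)
open import Data.List.Relation.Unary.All using (All)
open import Data.List.Membership.Propositional using (_∈_)
open import Data.Product using (_×_; _,_)
open import Relation.Binary.PropositionalEquality using (_≡_)

data Game : Set where
  ⟨_∣_⟩ : List Game → List Game → Game

leftOpts : Game → List Game
leftOpts ⟨ L ∣ R ⟩ = L

rightOpts : Game → List Game
rightOpts ⟨ L ∣ R ⟩ = R

zeroG : Game
zeroG = ⟨ [] ∣ [] ⟩

starG : Game
starG = ⟨ zeroG ∷ [] ∣ zeroG ∷ [] ⟩

-- disjunctive sum  G + H = { G^L + H , G + H^L | G^R + H , G + H^R }
mutual
  _+G_ : Game → Game → Game
  ⟨ GL ∣ GR ⟩ +G ⟨ HL ∣ HR ⟩ =
    ⟨ addR GL ⟨ HL ∣ HR ⟩ ++ addL ⟨ GL ∣ GR ⟩ HL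
    ∣ addR GR ⟨ HL ∣ HR ⟩ ++ addL ⟨ GL ∣ GR ⟩ HR ⟩

  addR : List Game → Game → List Game
  addR [] H = []
  addR (g ∷ gs) H = (g +G H) ∷ addR gs H

  addL : Game → List Game → List Game
  addL G [] = []
  addL G (h ∷ hs) = (G +G h) ∷ addL G hs

mutual
  conj : Game → Game
  conj ⟨ L ∣ R ⟩ = ⟨ conjs R ∣ conjs L ⟩

  conjs : List Game → List Game
  conjs [] = []
  conjs (g ∷ gs) = conj g ∷ conjs gs

-- misère outcomes
data Out : Set where
  𝓛 𝓡 : Out

mutual
  oL : Game → Out
  oL ⟨ [] ∣ R ⟩ = 𝓛
  oL ⟨ g ∷ gs ∣ R ⟩ = someRL (g ∷ gs)

  someRL : List Game → Out
  someRL [] = 𝓡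
  someRL (g ∷ gs) = pickL (oR g) (someRL gs)

  oR : Game → Out
  oR ⟨ L ∣ [] ⟩ = 𝓡
  oR ⟨ L ∣ g ∷ gs ⟩ = someLR (g ∷ gs)

  someLR : List Game → Out
  someLR [] = 𝓛
  someLR (g ∷ gs) = pickR (oL g) (someLR gs)

  pickL : Out → Out → Out
  pickL 𝓛 _ = 𝓛
  pickL 𝓡 o = o

  pickR : Out → Out → Out
  pickR 𝓡 _ = 𝓡
  pickR 𝓛 o = o

outcome : Game → Out × Out
outcome G = oL G , oR G

data NonEmpty {A : Set} : List A → Set where
  nonEmpty : ∀ {x xs} → NonEmpty (x ∷ xs)

data 𝒟 (𝒜 : Game → Set) : Game → Set where
  base    : ∀ {G} → 𝒜 G → 𝒟 𝒜 G
  optL    : ∀ {G g} → 𝒟 𝒜 G → g ∈ leftOpts G → 𝒟 𝒜 g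
  optR    : ∀ {G g} → 𝒟 𝒜 G → g ∈ rightOpts G → 𝒟 𝒜 g
  sum     : ∀ {G H} → 𝒟 𝒜 G → 𝒟 𝒜 H → 𝒟 𝒜 (G +G H)
  conjC   : ∀ {G} → 𝒟 𝒜 G → 𝒟 𝒜 (conj G)
  form    : ∀ {S T} → NonEmpty S → NonEmpty T → All (𝒟 𝒜) S → All (𝒟 𝒜) T
            → 𝒟 𝒜 ⟨ S ∣ T ⟩

_≡[_]_ : Game → (Game → Set) → Game → Set
G ≡[ 𝒰 ] H = ∀ X → 𝒰 X → outcome (G +G X) ≡ outcome (H +G X)

Gdot* : Game
Gdot* = ⟨ [] ∣ starG ∷ [] ⟩

-- Call a Right end X returnable if after every Left move Right can move back to a returnable
-- Right end.  Then Left, moving first in * + X, loses: Left's move * → 0 leaves Right without a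
-- move, which wins in misère play, and any Left move in X is answered by a return.  All Right ends in 𝒟(G) are
-- returnable, and the conjugates of all Left ends are, because this holds for G and its
-- followers, is preserved by sums and conjugates, and the forms {S | T} with S, T nonempty
-- are not ends.
-- For such X, G + X and X have the same outcomes: Left's moves correspond, and Right's extra
-- move G + X → * + X wins exactly when X is a Right end; otherwise, if every Right move in X
-- loses, Left answers it by * → 0, reaching X with Right to move.
module Submission where

open import Defs
open import Data.List using ([]; _∷_; _++_; map)
open import Data.List.Relation.Unary.All using (All; []; _∷_; lookup)
open import Data.List.Relation.Unary.Any using (here; there)
open import Data.List.Membership.Propositional using (_∈_)
open import Data.List.Membership.Propositional.Properties using (∈-map⁺; ∈-map⁻; ∈-++⁺ˡ; ∈-++⁺ʳ; ∈-++⁻)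
open import Data.Product using (_×_; _,_; ∃)
open import Data.Sum using (inj₁; inj₂)
open import Relation.Binary.PropositionalEquality
  using (_≡_; refl; sym; trans; cong; cong₂; subst; module ≡-Reasoning)

mutual
  +G-identityˡ : ∀ X → zeroG +G X ≡ X
  +G-identityˡ ⟨ L ∣ R ⟩ = cong₂ ⟨_∣_⟩ (addL-identityˡ L) (addL-identityˡ R)

  addL-identityˡ : ∀ xs → addL zeroG xs ≡ xs
  addL-identityˡ []       = refl
  addL-identityˡ (x ∷ xs) = cong₂ _∷_ (+G-identityˡ x) (addL-identityˡ xs)

mutual
  conj-involutive : ∀ G → conj (conj G) ≡ G
  conj-involutive ⟨ L ∣ R ⟩ = cong₂ ⟨_∣_⟩ (conjs-involutive L) (conjs-involutive R)

  conjs-involutive : ∀ gs → conjs (conjs gs) ≡ gs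
  conjs-involutive []       = refl
  conjs-involutive (g ∷ gs) = cong₂ _∷_ (conj-involutive g) (conjs-involutive gs)

conjs-++ : ∀ xs ys → conjs (xs ++ ys) ≡ conjs xs ++ conjs ys
conjs-++ []       ys = refl
conjs-++ (x ∷ xs) ys = cong (conj x ∷_) (conjs-++ xs ys)

mutual
  conj-distrib-+G : ∀ X Y → conj (X +G Y) ≡ conj X +G conj Y
  conj-distrib-+G X@(⟨ XL ∣ XR ⟩) Y@(⟨ YL ∣ YR ⟩) =
    cong₂ ⟨_∣_⟩
      (trans (conjs-++ (addR XR Y) (addL X YR)) (cong₂ _++_ (conjs-addR XR Y) (conjs-addL X YR)))
      (trans (conjs-++ (addR XL Y) (addL X YL)) (cong₂ _++_ (conjs-addR XL Y) (conjs-addL X YL)))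

  conjs-addR : ∀ xs Y → conjs (addR xs Y) ≡ addR (conjs xs) (conj Y)
  conjs-addR []       Y = refl
  conjs-addR (x ∷ xs) Y = cong₂ _∷_ (conj-distrib-+G x Y) (conjs-addR xs Y)

  conjs-addL : ∀ X ys → conjs (addL X ys) ≡ addL (conj X) (conjs ys)
  conjs-addL X []       = refl
  conjs-addL X (y ∷ ys) = cong₂ _∷_ (conj-distrib-+G X y) (conjs-addL X ys)

addR≡map : ∀ xs Y → addR xs Y ≡ map (_+G Y) xs
addR≡map []       Y = refl
addR≡map (x ∷ xs) Y = cong (x +G Y ∷_) (addR≡map xs Y)

addL≡map : ∀ X ys → addL X ys ≡ map (X +G_) ys
addL≡map X []       = refl
addL≡map X (y ∷ ys) = cong (X +G y ∷_) (addL≡map X ys)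

conjs≡map : ∀ xs → conjs xs ≡ map conj xs
conjs≡map []       = refl
conjs≡map (x ∷ xs) = cong (conj x ∷_) (conjs≡map xs)

leftOpts-+G : ∀ X Y → leftOpts (X +G Y) ≡ map (_+G Y) (leftOpts X) ++ map (X +G_) (leftOpts Y)
leftOpts-+G X@(⟨ XL ∣ _ ⟩) Y@(⟨ YL ∣ _ ⟩) = cong₂ _++_ (addR≡map XL Y) (addL≡map X YL)

rightOpts-+G : ∀ X Y → rightOpts (X +G Y) ≡ map (_+G Y) (rightOpts X) ++ map (X +G_) (rightOpts Y)
rightOpts-+G X@(⟨ _ ∣ XR ⟩) Y@(⟨ _ ∣ YR ⟩) = cong₂ _++_ (addR≡map XR Y) (addL≡map X YR)

∈-map-elim : ∀ {A B : Set} {Q : B → Set} (f : A → B) {xs} →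
             (∀ {x} → x ∈ xs → Q (f x)) → ∀ {z} → z ∈ map f xs → Q z
∈-map-elim f q m with ∈-map⁻ f m
... | _ , x∈ , refl = q x∈

leftOpts-+G-elim : ∀ {Q : Game → Set} X Y →
                   (∀ {x} → x ∈ leftOpts X → Q (x +G Y)) → (∀ {y} → y ∈ leftOpts Y → Q (X +G y)) →
                   ∀ {z} → z ∈ leftOpts (X +G Y) → Q z
leftOpts-+G-elim X Y qX qY m
  with ∈-++⁻ (map (_+G Y) (leftOpts X)) (subst (_ ∈_) (leftOpts-+G X Y) m)
... | inj₁ m′ = ∈-map-elim (_+G Y) qX m′
... | inj₂ m′ = ∈-map-elim (X +G_) qY m′

rightOpts-+G-elim : ∀ {Q : Game → Set} X Y →
                    (∀ {x} → x ∈ rightOpts X → Q (x +G Y)) → (∀ {y} → y ∈ rightOpts Y → Q (X +G y)) →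
                    ∀ {z} → z ∈ rightOpts (X +G Y) → Q z
rightOpts-+G-elim X Y qX qY m
  with ∈-++⁻ (map (_+G Y) (rightOpts X)) (subst (_ ∈_) (rightOpts-+G X Y) m)
... | inj₁ m′ = ∈-map-elim (_+G Y) qX m′
... | inj₂ m′ = ∈-map-elim (X +G_) qY m′

conjs-elim : ∀ {Q : Game → Set} xs → (∀ {x} → x ∈ xs → Q (conj x)) → ∀ {z} → z ∈ conjs xs → Q z
conjs-elim xs q m = ∈-map-elim conj q (subst (_ ∈_) (conjs≡map xs) m)

∈-rightOpts-+G⁺ˡ : ∀ X Y {x} → x ∈ rightOpts X → x +G Y ∈ rightOpts (X +G Y)
∈-rightOpts-+G⁺ˡ X Y m = subst (_ ∈_) (sym (rightOpts-+G X Y)) (∈-++⁺ˡ (∈-map⁺ (_+G Y) m))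

∈-rightOpts-+G⁺ʳ : ∀ X Y {y} → y ∈ rightOpts Y → X +G y ∈ rightOpts (X +G Y)
∈-rightOpts-+G⁺ʳ X Y m =
  subst (_ ∈_) (sym (rightOpts-+G X Y)) (∈-++⁺ʳ (map (_+G Y) (rightOpts X)) (∈-map⁺ (X +G_) m))

RightEnd LeftEnd : Game → Set
RightEnd G = rightOpts G ≡ []
LeftEnd  G = leftOpts G ≡ []

RightEnd-+G⁻ : ∀ X Y → RightEnd (X +G Y) → RightEnd X × RightEnd Y
RightEnd-+G⁻ ⟨ _ ∣ [] ⟩    ⟨ _ ∣ [] ⟩    _ = refl , refl
RightEnd-+G⁻ ⟨ _ ∣ _ ∷ _ ⟩ ⟨ _ ∣ _ ⟩     ()
RightEnd-+G⁻ ⟨ _ ∣ [] ⟩    ⟨ _ ∣ _ ∷ _ ⟩ ()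

LeftEnd-+G⁻ : ∀ X Y → LeftEnd (X +G Y) → LeftEnd X × LeftEnd Y
LeftEnd-+G⁻ ⟨ [] ∣ _ ⟩    ⟨ [] ∣ _ ⟩    _ = refl , refl
LeftEnd-+G⁻ ⟨ _ ∷ _ ∣ _ ⟩ ⟨ _ ∣ _ ⟩     ()
LeftEnd-+G⁻ ⟨ [] ∣ _ ⟩    ⟨ _ ∷ _ ∣ _ ⟩ ()

LeftEnd-conj⁻ : ∀ G → RightEnd (conj G) → LeftEnd G
LeftEnd-conj⁻ ⟨ [] ∣ _ ⟩ _ = refl
LeftEnd-conj⁻ ⟨ _ ∷ _ ∣ _ ⟩ ()

RightEnd-conj⁻ : ∀ G → LeftEnd (conj G) → RightEnd G
RightEnd-conj⁻ ⟨ _ ∣ [] ⟩ _ = refl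
RightEnd-conj⁻ ⟨ _ ∣ _ ∷ _ ⟩ ()

data Hereditary (P : Game → Set) : Game → Set where
  hereditary : ∀ {G} → P G →
               (∀ {g} → g ∈ leftOpts G → Hereditary P g) →
               (∀ {g} → g ∈ rightOpts G → Hereditary P g) →
               Hereditary P G

module _ {P : Game → Set} where

  Hereditary-leftOpts : ∀ {G g} → Hereditary P G → g ∈ leftOpts G → Hereditary P g
  Hereditary-leftOpts (hereditary _ left _) = left

  Hereditary-rightOpts : ∀ {G g} → Hereditary P G → g ∈ rightOpts G → Hereditary P g
  Hereditary-rightOpts (hereditary _ _ right) = right

module _ {P : Game → Set}
         (P-+G : ∀ {X Y} → P X → P Y → P (X +G Y))
         (P-conj : ∀ {X} → P X → P (conj X)) where

  Hereditary-+G : ∀ {X Y} → Hereditary P X → Hereditary P Y → Hereditary P (X +G Y)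
  Hereditary-+G {X} {Y} hX@(hereditary pX leftX rightX) hY@(hereditary pY leftY rightY) =
    hereditary (P-+G pX pY)
      (leftOpts-+G-elim X Y (λ x∈ → Hereditary-+G (leftX x∈) hY) (λ y∈ → Hereditary-+G hX (leftY y∈)))
      (rightOpts-+G-elim X Y (λ x∈ → Hereditary-+G (rightX x∈) hY) (λ y∈ → Hereditary-+G hX (rightY y∈)))

  Hereditary-conj : ∀ {X} → Hereditary P X → Hereditary P (conj X)
  Hereditary-conj {⟨ L ∣ R ⟩} (hereditary pX leftX rightX) =
    hereditary (P-conj pX)
      (conjs-elim R (λ x∈ → Hereditary-conj (rightX x∈)))
      (conjs-elim L (λ x∈ → Hereditary-conj (leftX x∈)))

  module _ {𝒜 : Game → Set}
           (𝒜⊆ : ∀ {G} → 𝒜 G → Hereditary P G)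
           (P-form : ∀ {s S t T} → P ⟨ s ∷ S ∣ t ∷ T ⟩) where

    mutual
      𝒟⊆Hereditary : ∀ {G} → 𝒟 𝒜 G → Hereditary P G
      𝒟⊆Hereditary (base a)    = 𝒜⊆ a
      𝒟⊆Hereditary (optL d m)  = Hereditary-leftOpts (𝒟⊆Hereditary d) m
      𝒟⊆Hereditary (optR d m)  = Hereditary-rightOpts (𝒟⊆Hereditary d) m
      𝒟⊆Hereditary (sum d e)   = Hereditary-+G (𝒟⊆Hereditary d) (𝒟⊆Hereditary e)
      𝒟⊆Hereditary (conjC d)   = Hereditary-conj (𝒟⊆Hereditary d)
      𝒟⊆Hereditary (form nonEmpty nonEmpty ds es) =
        hereditary P-form (lookup (All-𝒟⊆Hereditary ds)) (lookup (All-𝒟⊆Hereditary es))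

      All-𝒟⊆Hereditary : ∀ {gs} → All (𝒟 𝒜) gs → All (Hereditary P) gs
      All-𝒟⊆Hereditary []       = []
      All-𝒟⊆Hereditary (d ∷ ds) = 𝒟⊆Hereditary d ∷ All-𝒟⊆Hereditary ds

pickR-zeroʳ : ∀ a → pickR a 𝓡 ≡ 𝓡
pickR-zeroʳ 𝓛 = refl
pickR-zeroʳ 𝓡 = refl

pickR-redundantˡ : ∀ a b → (b ≡ 𝓛 → a ≡ 𝓛) → pickR a b ≡ b
pickR-redundantˡ 𝓛 b _ = refl
pickR-redundantˡ 𝓡 𝓡 _ = refl
pickR-redundantˡ 𝓡 𝓛 h = h refl

someRL-𝓡⁺ : ∀ {xs} → (∀ {x} → x ∈ xs → oR x ≡ 𝓡) → someRL xs ≡ 𝓡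
someRL-𝓡⁺ {[]}     _ = refl
someRL-𝓡⁺ {x ∷ xs} q rewrite q (here refl) = someRL-𝓡⁺ (λ m → q (there m))

someLR-𝓡⁺ : ∀ {xs x} → x ∈ xs → oL x ≡ 𝓡 → someLR xs ≡ 𝓡
someLR-𝓡⁺ (here refl) e rewrite e = refl
someLR-𝓡⁺ {y ∷ _} (there m) e rewrite someLR-𝓡⁺ m e = pickR-zeroʳ (oL y)

oR-𝓡⁺ : ∀ G {x} → x ∈ rightOpts G → oL x ≡ 𝓡 → oR G ≡ 𝓡
oR-𝓡⁺ ⟨ _ ∣ _ ∷ _ ⟩ m e = someLR-𝓡⁺ m e

someRL-addL-cong : ∀ G {xs} → (∀ {x} → x ∈ xs → oR (G +G x) ≡ oR x) → someRL (addL G xs) ≡ someRL xs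
someRL-addL-cong G {[]}     _ = refl
someRL-addL-cong G {x ∷ xs} q = cong₂ pickL (q (here refl)) (someRL-addL-cong G (λ m → q (there m)))

someLR-addL-cong : ∀ G {xs} → (∀ {x} → x ∈ xs → oL (G +G x) ≡ oL x) → someLR (addL G xs) ≡ someLR xs
someLR-addL-cong G {[]}     _ = refl
someLR-addL-cong G {x ∷ xs} q = cong₂ pickR (q (here refl)) (someLR-addL-cong G (λ m → q (there m)))

data ReturnableRightEnd : Game → Set

RightReturnsFrom : Game → Set
RightReturnsFrom x = ∃ λ y → y ∈ rightOpts x × ReturnableRightEnd y

data ReturnableRightEnd where
  returnable : ∀ {L} → (∀ {x} → x ∈ L → RightReturnsFrom x) → ReturnableRightEnd ⟨ L ∣ [] ⟩

ReturnableRightEnd-+G : ∀ {X Y} → ReturnableRightEnd X → ReturnableRightEnd Y → ReturnableRightEnd (X +G Y)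
ReturnableRightEnd-+G {X} {Y} rX@(returnable replyX) rY@(returnable replyY) =
  returnable (leftOpts-+G-elim {RightReturnsFrom} X Y
    (λ {x} x∈ → let w , w∈ , rw = replyX x∈ in
                w +G Y , ∈-rightOpts-+G⁺ˡ x Y w∈ , ReturnableRightEnd-+G rw rY)
    (λ {y} y∈ → let w , w∈ , rw = replyY y∈ in
                X +G w , ∈-rightOpts-+G⁺ʳ X y w∈ , ReturnableRightEnd-+G rX rw))

oL-starG+-𝓡 : ∀ {X} → ReturnableRightEnd X → oL (starG +G X) ≡ 𝓡
oL-starG+-𝓡 {X} (returnable reply) =
  someRL-𝓡⁺ (leftOpts-+G-elim starG X
    (λ { (here refl) → refl ; (there ()) })
    (λ {x} x∈ → let w , w∈ , rw = reply x∈ in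
                oR-𝓡⁺ (starG +G x) (∈-rightOpts-+G⁺ʳ starG x w∈) (oL-starG+-𝓡 rw)))

oL-starG+-𝓛 : ∀ X → oR X ≡ 𝓛 → oL (starG +G X) ≡ 𝓛
oL-starG+-𝓛 X@(⟨ L ∣ _ ⟩) e = cong (λ o → pickL o (someRL (addL starG L))) (trans (cong oR (+G-identityˡ X)) e)

EndsReturnable : Game → Set
EndsReturnable G = (RightEnd G → ReturnableRightEnd G) × (LeftEnd G → ReturnableRightEnd (conj G))

EndsReturnable-+G : ∀ {X Y} → EndsReturnable X → EndsReturnable Y → EndsReturnable (X +G Y)
EndsReturnable-+G {X} {Y} (rX , lX) (rY , lY) =
  (λ e → let eX , eY = RightEnd-+G⁻ X Y e in ReturnableRightEnd-+G (rX eX) (rY eY)) ,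
  (λ e → let eX , eY = LeftEnd-+G⁻ X Y e in
         subst ReturnableRightEnd (sym (conj-distrib-+G X Y)) (ReturnableRightEnd-+G (lX eX) (lY eY)))

EndsReturnable-conj : ∀ {X} → EndsReturnable X → EndsReturnable (conj X)
EndsReturnable-conj {X} (rX , lX) =
  (λ e → lX (LeftEnd-conj⁻ X e)) ,
  (λ e → subst ReturnableRightEnd (sym (conj-involutive X)) (rX (RightEnd-conj⁻ X e)))

WellEnded : Game → Set
WellEnded = Hereditary EndsReturnable

mutual
  oL-Gdot*+ : ∀ {X} → WellEnded X → oL (Gdot* +G X) ≡ oL X
  oL-Gdot*+ {⟨ [] ∣ _ ⟩}    _                      = refl
  oL-Gdot*+ {⟨ _ ∷ _ ∣ _ ⟩} (hereditary _ left _) = someRL-addL-cong Gdot* (λ m → oR-Gdot*+ (left m))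

  oR-Gdot*+ : ∀ {X} → WellEnded X → oR (Gdot* +G X) ≡ oR X
  oR-Gdot*+ {⟨ _ ∣ [] ⟩} (hereditary (rX , _) _ _) = cong (λ o → pickR o 𝓛) (oL-starG+-𝓡 (rX refl))
  oR-Gdot*+ {X@(⟨ _ ∣ r ∷ rs ⟩)} (hereditary _ _ right) = begin
    pickR (oL (starG +G X)) (someLR (addL Gdot* (r ∷ rs)))
      ≡⟨ cong (pickR (oL (starG +G X))) (someLR-addL-cong Gdot* (λ m → oL-Gdot*+ (right m))) ⟩
    pickR (oL (starG +G X)) (oR X)
      ≡⟨ pickR-redundantˡ _ _ (oL-starG+-𝓛 X) ⟩
    oR X ∎
    where open ≡-Reasoning

zeroG-WellEnded : WellEnded zeroG
zeroG-WellEnded = hereditary ((λ _ → returnable λ ()) , (λ _ → returnable λ ())) (λ ()) (λ ())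

starG-WellEnded : WellEnded starG
starG-WellEnded =
  hereditary ((λ ()) , (λ ())) (λ { (here refl) → zeroG-WellEnded }) (λ { (here refl) → zeroG-WellEnded })

Gdot*-WellEnded : WellEnded Gdot*
Gdot*-WellEnded =
  hereditary ((λ ()) , λ _ → returnable λ { (here refl) → zeroG , here refl , returnable λ () })
             (λ ())
             (λ { (here refl) → starG-WellEnded })

𝒟Gdot*⊆WellEnded : ∀ {X} → 𝒟 (_≡ Gdot*) X → WellEnded X
𝒟Gdot*⊆WellEnded =
  𝒟⊆Hereditary EndsReturnable-+G EndsReturnable-conj (λ { refl → Gdot*-WellEnded }) ((λ ()) , (λ ()))

proposition7p2 : Gdot* ≡[ 𝒟 (_≡ Gdot*) ] zeroG
proposition7p2 X X∈𝒰 = begin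
  outcome (Gdot* +G X)  ≡⟨ cong₂ _,_ (oL-Gdot*+ wellEnded) (oR-Gdot*+ wellEnded) ⟩
  outcome X             ≡⟨ cong outcome (sym (+G-identityˡ X)) ⟩
  outcome (zeroG +G X)  ∎
  where
  open ≡-Reasoning
  wellEnded : WellEnded X
  wellEnded = 𝒟Gdot*⊆WellEnded X∈𝒰
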